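{- Let $(N,E)$, $\le$ and $C$ be as in the context. Then $\le$ is compatible with $C$, i.e. whenever $x<y<z$ we have $C(x;y,z)\vee C(z;x,y)$; and $(N,C,\le)$ is strongly dense: $C$ is proper (satisfies (C5) $\exists x\,C(x;y,z)$ and (C6) $x\ne y\to\exists z(y\ne z\wedge C(x;y,z))$), $(N,\le)$ is a dense linear order without endpoints, and (C8) holds: whenever $C(x;y,z)$ there exist $w_1,w_2\in N$ with $C(w_1;y,z)\wedge C(x;y,w_1)\wedge w_1<\min\{y,z\}$ and $C(w_2;y,z)\wedge C(x;y,w_2)\wedge\max\{y,z\}<w_2$.
   Context: Standing assumptions: $(N,E)$ is a countably infinite $3$-hypergraph (edges are $3$-element subsets) which is $\le4$-set-homogeneous (for $t=1,\dots,4$, whenever $U,V\subseteq N$ with $|U|=|V|=t$ carry isomorphic induced subhypergraphs there is $g\in\mathrm{Aut}(N,E)$ with $U^g=V$), whose automorphism group $K$ is not $2$-transitive, and $\le$ is a $K$-invariant linear order on $N$. Further it is assumed that: there are $u_1<u_2<u_3<u_4$ in $N$ with exactly two edges among their $3$-subsets, these edges intersecting in $\{u_3,u_4\}$; there are $u_1<\dots<u_4$ with exactly one edge, namely $\{u_1,u_2,u_3\}$; and there are $u_1<\dots<u_4$ with exactly three edges, intersecting in $\{u_1\}$. Define $C(x;y,z)$ to hold iff (a) $y=z\ne x$; or (b) $x,y,z$ are distinct, $x<\min\{y,z\}$ and $\{x,y,z\}\in E$; or (c) $x,y,z$ are distinct, $\max\{y,z\}<x$ and $\{x,y,z\}\notin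 E$. -}

module Defs where

open import Level using (0ℓ)
open import Data.Nat using (ℕ)
open import Data.Fin using (Fin)
open import Data.Product using (Σ; ∃; ∃-syntax; _×_; _,_)
open import Data.Sum using (_⊎_)
open import Data.Empty using (⊥)
open import Relation.Nullary using (¬_)
open import Relation.Binary.PropositionalEquality using (_≡_; _≢_)
open import Relation.Binary.Structures using (IsTotalOrder)
open import Function.Bundles using (_⤖_; _⇔_; Bijection)
open import Function.Definitions using (Injective)

-- 3-hypergraphs on a carrier N: E x y z means {x,y,z} is an edge.
-- Edges are 3-element subsets: E only holds on pairwise distinct
-- triples and is invariant under permuting the three arguments.

Distinct3 : {N : Set} → N → N → N → Set
Distinct3 x y z = x ≢ y × y ≢ z × x ≢ z

record Is3Hypergraph (N : Set) (E : N → N → N → Set) : Set where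
  field
    distinct : ∀ {x y z} → E x y z → Distinct3 x y z
    swap₁₂   : ∀ {x y z} → E x y z → E y x z
    swap₂₃   : ∀ {x y z} → E x y z → E x z y

IsAut : {N : Set} → (N → N → N → Set) → (N ⤖ N) → Set
IsAut {N} E g = ∀ (x y z : N) → E x y z ⇔ E (f x) (f y) (f z)
  where f = Bijection.to g

-- A t-subset of N given by an injective enumeration u : Fin t → N.
-- The induced subhypergraphs on U = im u and V = im v are isomorphic
-- iff there is a bijection π of Fin t (i.e. a bijection U → V,
-- u i ↦ v (π i)) preserving edges and non-edges.
InducedIso : {N : Set} → (N → N → N → Set) → ∀ {t} →
             (Fin t → N) → (Fin t → N) → Set
InducedIso E {t} u v =
  Σ (Fin t → Fin t) λ π → Injective _≡_ _≡_ π ×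
    (∀ i j k → E (u i) (u j) (u k) ⇔ E (v (π i)) (v (π j)) (v (π k)))

MapsOnto : {N : Set} → (N → N) → ∀ {t} → (Fin t → N) → (Fin t → N) → Set
MapsOnto g {t} u v = (∀ i → ∃[ j ] g (u i) ≡ v j) × (∀ j → ∃[ i ] g (u i) ≡ v j)

-- ≤4-set-homogeneity: for t = 1,…,4 (t = 0 is trivial and harmless).
SetHomogeneous≤4 : {N : Set} → (N → N → N → Set) → Set
SetHomogeneous≤4 {N} E =
  ∀ (t : ℕ) → t Data.Nat.≤ 4 → (u v : Fin t → N) →
    Injective _≡_ _≡_ u → Injective _≡_ _≡_ v →
    InducedIso E u v →
    Σ (N ⤖ N) λ g → IsAut E g × MapsOnto (Bijection.to g) u v

TwoTransitive : {N : Set} → (N → N → N → Set) → Set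
TwoTransitive {N} E =
  ∀ (a b c d : N) → a ≢ b → c ≢ d →
    Σ (N ⤖ N) λ g → IsAut E g × Bijection.to g a ≡ c × Bijection.to g b ≡ d

record Setting (N : Set) (E : N → N → N → Set) (_≤_ : N → N → Set) : Set₁ where
  field
    countablyInfinite : ℕ ⤖ N
    hypergraph        : Is3Hypergraph N E
    homogeneous       : SetHomogeneous≤4 E
    notTwoTransitive  : ¬ TwoTransitive E
    linearOrder       : IsTotalOrder _≡_ _≤_
    invariantOrder    : ∀ (g : N ⤖ N) → IsAut E g →
                        ∀ x y → x ≤ y → Bijection.to g x ≤ Bijection.to g y
  _<_ : N → N → Set
  x < y = x ≤ y × x ≢ y
  field
    config₂ : ∃[ u₁ ] ∃[ u₂ ] ∃[ u₃ ] ∃[ u₄ ]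
      (u₁ < u₂ × u₂ < u₃ × u₃ < u₄ ×
       ¬ E u₁ u₂ u₃ × ¬ E u₁ u₂ u₄ × E u₁ u₃ u₄ × E u₂ u₃ u₄)
    config₁ : ∃[ u₁ ] ∃[ u₂ ] ∃[ u₃ ] ∃[ u₄ ]
      (u₁ < u₂ × u₂ < u₃ × u₃ < u₄ ×
       E u₁ u₂ u₃ × ¬ E u₁ u₂ u₄ × ¬ E u₁ u₃ u₄ × ¬ E u₂ u₃ u₄)
    config₃ : ∃[ u₁ ] ∃[ u₂ ] ∃[ u₃ ] ∃[ u₄ ]
      (u₁ < u₂ × u₂ < u₃ × u₃ < u₄ ×
       E u₁ u₂ u₃ × E u₁ u₂ u₄ × E u₁ u₃ u₄ × ¬ E u₂ u₃ u₄)

module _ {N : Set} (E : N → N → N → Set) (_≤_ : N → N → Set) where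

  Lt : N → N → Set
  Lt x y = x ≤ y × x ≢ y

  -- C(x; y, z).  x < min{y,z} ⟺ x<y ∧ x<z ;  max{y,z} < x ⟺ y<x ∧ z<x.
  C : N → N → N → Set
  C x y z =
      (y ≡ z × y ≢ x)
    ⊎ (Distinct3 x y z × Lt x y × Lt x z × E x y z)
    ⊎ (Distinct3 x y z × Lt y x × Lt z x × ¬ E x y z)

  Compatible : Set
  Compatible = ∀ x y z → Lt x y → Lt y z → C x y z ⊎ C z x y

  C5 : Set
  C5 = ∀ y z → ∃[ x ] C x y z

  C6 : Set
  C6 = ∀ x y → x ≢ y → ∃[ z ] (y ≢ z × C x y z)

  Proper : Set
  Proper = C5 × C6

  DenseNoEndpoints : Set
  DenseNoEndpoints =
      (∀ x y → Lt x y → ∃[ z ] (Lt x z × Lt z y))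
    × (∀ x → ∃[ y ] Lt y x)
    × (∀ x → ∃[ y ] Lt x y)

  C8 : Set
  C8 = ∀ x y z → C x y z →
      (∃[ w₁ ] (C w₁ y z × C x y w₁ × Lt w₁ y × Lt w₁ z))
    × (∃[ w₂ ] (C w₂ y z × C x y w₂ × Lt y w₂ × Lt z w₂))

  StronglyDense : Set
  StronglyDense = Proper × DenseNoEndpoints × C8

-- Everything rests on one extension principle. Automorphisms preserve the invariant order, and
-- an order-preserving bijection between two finite chains is unique; so ≤4-set-homogeneity
-- carries any increasing tuple of length ≤ 4 onto any other one whose induced hypergraph is
-- isomorphic to it, entry by entry. Consequently a new point can be inserted into a tuple of
-- length ≤ 3 at any position at which it occurs in a known example, and increasing quadruples
-- with the same number of edges (on four points the number of edges determines the isomorphism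
-- type) have the same ordered pattern. Comparing with the three given configurations, an
-- increasing quadruple whose triples abc and bcd are edges is complete, and one whose triples
-- abc and acd are non-edges is empty; extension produces both kinds. Each requirement of
-- compatibility, density, (C5), (C6) and (C8) asks for a point in a prescribed position
-- relative to one, two or three given points with prescribed edges, and is met by extending a
-- suitable example.

module Submission where

open import Defs
open import Level using (0ℓ)
open import Data.Product using (_×_)
open import Axiom.ExcludedMiddle using (ExcludedMiddle)

open import Data.Bool using (Bool; true; false)
open import Data.Empty using (⊥; ⊥-elim)
open import Data.Product using (∃-syntax; _,_; proj₁; proj₂)
open import Data.Sum using (inj₁; inj₂)
open import Data.Nat as ℕ using (suc; z≤n; s≤s; z<s; s<s)
import Data.Nat.Properties as ℕₚ
open import Data.Fin as Fin using (Fin; zero; suc; punchIn; punchOut; opposite; inject₁)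
import Data.Fin.Properties as Finₚ
open import Data.Fin.Patterns using (0F; 1F; 2F; 3F)
open import Data.Fin.Permutation as Perm
  using (Permutation′; _⟨$⟩ʳ_; _⟨$⟩ˡ_; inverseˡ; inverseʳ; transpose)
open import Data.Vec using (Vec; []; _∷_; lookup; map; insertAt; removeAt)
open import Data.Vec.Properties
  using (lookup-map; map-insertAt; insertAt-punchIn; insertAt-removeAt; tabulate∘lookup; tabulate-cong)
open import Data.Vec.Relation.Unary.Linked as Linked using (Linked; []; [-]; _∷_)
open import Data.Vec.Relation.Unary.Linked.Properties as Linkedₚ using ()
open import Relation.Nullary using (¬_; Dec; yes; no)
open import Relation.Nullary.Decidable using (True; toWitness; _×-dec_; _→-dec_)
open import Relation.Binary.PropositionalEquality
open import Relation.Binary.Definitions using (Transitive; tri<; tri≈; tri>)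
open import Relation.Binary.Structures using (IsStrictTotalOrder)
import Relation.Binary.Construct.NonStrictToStrict as NonStrictToStrict
open import Function.Base using (_∘_; _∘₂_; case_of_)
open import Function.Bundles using (_⇔_; mk⇔; Equivalence; Bijection; _⤖_)
open import Function.Definitions using (Injective)
import Function.Properties.Equivalence as ⇔

-- Finite ordinals

StrictlyIncreasing : ∀ {m n} → (Fin m → Fin n) → Set
StrictlyIncreasing σ = ∀ {i j} → i Fin.< j → σ i Fin.< σ j

strictlyIncreasing⇒≤ : ∀ {m n} (σ : Fin m → Fin n) → StrictlyIncreasing σ →
                       ∀ i → i Fin.≤ σ i
strictlyIncreasing⇒≤ σ σ↑ zero    = z≤n
strictlyIncreasing⇒≤ σ σ↑ (suc i) =
  ℕₚ.≤-trans (s≤s (strictlyIncreasing⇒≤ (σ ∘ inject₁) (σ↑ ∘ inject₁-mono) i))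
             (σ↑ (Finₚ.≤̄⇒inject₁< Finₚ.≤-refl))
  where
  inject₁-mono : ∀ {m} {i j : Fin m} → i Fin.< j → inject₁ i Fin.< inject₁ j
  inject₁-mono {i = i} {j} = subst₂ ℕ._<_ (sym (Finₚ.toℕ-inject₁ i)) (sym (Finₚ.toℕ-inject₁ j))

opposite-< : ∀ {n} {i j : Fin n} → i Fin.< j → opposite j Fin.< opposite i
opposite-< {n} {i} {j} i<j rewrite Finₚ.opposite-prop i | Finₚ.opposite-prop j =
  ℕₚ.∸-monoʳ-< (s<s i<j) (Finₚ.toℕ<n j)

-- Applied to opposite ∘ σ ∘ opposite, the lower bound i ≤ σ i becomes an upper bound.
strictlyIncreasing⇒≗id : ∀ {n} (σ : Fin n → Fin n) → StrictlyIncreasing σ → ∀ i → σ i ≡ i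
strictlyIncreasing⇒≗id σ σ↑ i = Finₚ.≤-antisym σi≤i (strictlyIncreasing⇒≤ σ σ↑ i)
  where
  opposite≤ : opposite i Fin.≤ opposite (σ i)
  opposite≤ = subst (λ k → opposite i Fin.≤ opposite (σ k)) (Finₚ.opposite-involutive i)
    (strictlyIncreasing⇒≤ (opposite ∘ σ ∘ opposite) (opposite-< ∘ σ↑ ∘ opposite-<) (opposite i))
  σi≤i : σ i Fin.≤ i
  σi≤i = ℕₚ.≮⇒≥ λ i<σi → ℕₚ.<⇒≱ (opposite-< i<σi) opposite≤

punchIn-strictlyIncreasing : ∀ {n} (k : Fin (suc n)) → StrictlyIncreasing (punchIn k)
punchIn-strictlyIncreasing zero    i<j                   = s<s i<j
punchIn-strictlyIncreasing (suc k) {zero}  {suc j} _     = z<s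
punchIn-strictlyIncreasing (suc k) {suc i} {suc j} (s<s i<j) = s<s (punchIn-strictlyIncreasing k i<j)

noIncreasingTriple : ∀ {n} → n ℕ.≤ 2 → {i j k : Fin n} → i Fin.< j → j Fin.< k → ⊥
noIncreasingTriple n≤2 {k = k} i<j j<k =
  ℕₚ.≤⇒≯ n≤2 (ℕₚ.≤-trans (s≤s 2≤k) (Finₚ.toℕ<n k))
  where
  2≤k : 2 ℕ.≤ Fin.toℕ k
  2≤k = ℕₚ.≤-trans (s≤s (ℕₚ.≤-trans (s≤s z≤n) i<j)) j<k

increasingTriple₃ : ∀ (i j k : Fin 3) → i Fin.< j → j Fin.< k → i ≡ 0F × j ≡ 1F × k ≡ 2F
increasingTriple₃ = toWitness {a? = Finₚ.all? λ i → Finₚ.all? λ j → Finₚ.all? λ k →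
  i Finₚ.<? j →-dec j Finₚ.<? k →-dec (i Finₚ.≟ 0F ×-dec j Finₚ.≟ 1F ×-dec k Finₚ.≟ 2F)} _

increasingTriple₄ : ∀ (i j k : Fin 4) → i Fin.< j → j Fin.< k →
  ∃[ x ] (i ≡ punchIn x 0F × j ≡ punchIn x 1F × k ≡ punchIn x 2F)
increasingTriple₄ = toWitness {a? = Finₚ.all? λ i → Finₚ.all? λ j → Finₚ.all? λ k →
  i Finₚ.<? j →-dec j Finₚ.<? k →-dec Finₚ.any? λ x →
    i Finₚ.≟ punchIn x 0F ×-dec j Finₚ.≟ punchIn x 1F ×-dec k Finₚ.≟ punchIn x 2F} _

permutation-injective : ∀ {n} (π : Permutation′ n) → Injective _≡_ _≡_ (π ⟨$⟩ʳ_)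
permutation-injective π {i} {j} πi≡πj =
  trans (sym (inverseˡ π)) (trans (cong (π ⟨$⟩ˡ_) πi≡πj) (inverseˡ π))

module _ {A : Set} {R : A → A → Set} (R-trans : Transitive R) where

  linked⇒lookup-mono : ∀ {n} {xs : Vec A n} → Linked R xs →
                       ∀ {i j} → i Fin.< j → R (lookup xs i) (lookup xs j)
  linked⇒lookup-mono {xs = _ ∷ _ ∷ _} (r ∷ rs) {zero}  {suc zero}    _         = r
  linked⇒lookup-mono {xs = _ ∷ _ ∷ _} (r ∷ rs) {zero}  {suc (suc j)} _         =
    R-trans r (linked⇒lookup-mono rs {zero} {suc j} z<s)
  linked⇒lookup-mono {xs = _ ∷ _ ∷ _} (r ∷ rs) {suc i} {suc j}      (s<s i<j) =
    linked⇒lookup-mono rs i<j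

lookup-mono⇒linked : ∀ {A : Set} {R : A → A → Set} {n} {xs : Vec A n} →
                     (∀ {i j} → i Fin.< j → R (lookup xs i) (lookup xs j)) → Linked R xs
lookup-mono⇒linked {xs = []}         mono = []
lookup-mono⇒linked {xs = x ∷ []}     mono = [-]
lookup-mono⇒linked {xs = x ∷ y ∷ xs} mono = mono {0F} {1F} z<s ∷ lookup-mono⇒linked (mono ∘ s<s)

lookup-ext : ∀ {A : Set} {n} {xs ys : Vec A n} → (∀ i → lookup xs i ≡ lookup ys i) → xs ≡ ys
lookup-ext {xs = xs} {ys} eq =
  trans (sym (tabulate∘lookup xs)) (trans (tabulate-cong eq) (tabulate∘lookup ys))

-- 3-hypergraphs

pullback : ∀ {M N : Set} {E : N → N → N → Set} → Is3Hypergraph N E → (f : M → N) →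
           Is3Hypergraph M (λ x y z → E (f x) (f y) (f z))
pullback hyp f = record
  { distinct = λ e → let (xy , yz , xz) = distinct e in xy ∘ cong f , yz ∘ cong f , xz ∘ cong f
  ; swap₁₂   = swap₁₂
  ; swap₂₃   = swap₂₃
  }
  where open Is3Hypergraph hyp

-- Sorting the three arguments reduces every triple to an increasing one.
module _ {A : Set} {_<_ : A → A → Set} (sto : IsStrictTotalOrder _≡_ _<_)
         {H H′ : A → A → A → Set} (hyp : Is3Hypergraph A H) (hyp′ : Is3Hypergraph A H′)
         (agree : ∀ {x y z} → x < y → y < z → H x y z → H′ x y z) where

  open IsStrictTotalOrder sto using (compare)
  open Is3Hypergraph hyp
  open Is3Hypergraph hyp′ using () renaming (swap₁₂ to swap₁₂′; swap₂₃ to swap₂₃′)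

  private
    fromIncreasingTriples-< : ∀ {x y z} → x < y → H x y z → H′ x y z
    fromIncreasingTriples-< {x} {y} {z} x<y h with compare y z
    ... | tri< y<z _ _ = agree x<y y<z h
    ... | tri≈ _ refl _ = ⊥-elim (proj₁ (proj₂ (distinct h)) refl)
    ... | tri> _ _ z<y with compare x z
    ...   | tri< x<z _ _ = swap₂₃′ (agree x<z z<y (swap₂₃ h))
    ...   | tri≈ _ refl _ = ⊥-elim (proj₂ (proj₂ (distinct h)) refl)
    ...   | tri> _ _ z<x = swap₂₃′ (swap₁₂′ (agree z<x x<y (swap₁₂ (swap₂₃ h))))

  fromIncreasingTriples : ∀ {x y z} → H x y z → H′ x y z
  fromIncreasingTriples {x} {y} h with compare x y
  ... | tri< x<y _ _ = fromIncreasingTriples-< x<y h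
  ... | tri≈ _ refl _ = ⊥-elim (proj₁ (distinct h) refl)
  ... | tri> _ _ y<x = swap₁₂′ (fromIncreasingTriples-< y<x (swap₁₂ h))

Complementary : ∀ {n} → (Fin n → Set) → Fin n → Fin n → Fin n → Set
Complementary P i j k = Distinct3 i j k × (∀ x → x ≢ i → x ≢ j → x ≢ k → P x)

complementary-hypergraph : ∀ {n} (P : Fin n → Set) → Is3Hypergraph (Fin n) (Complementary P)
complementary-hypergraph P = record
  { distinct = proj₁
  ; swap₁₂   = λ ((ij , jk , ik) , f) → (≢-sym ij , ik , jk) , λ x xj xi xk → f x xi xj xk
  ; swap₂₃   = λ ((ij , jk , ik) , f) → (ik , ≢-sym jk , ij) , λ x xi xk xj → f x xi xj xk
  }

complementary-permute : ∀ {n} {P Q : Fin n → Set} (π : Permutation′ n) →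
  (∀ x → P x ⇔ Q (π ⟨$⟩ʳ x)) →
  ∀ {i j k} → Complementary P i j k ⇔ Complementary Q (π ⟨$⟩ʳ i) (π ⟨$⟩ʳ j) (π ⟨$⟩ʳ k)
complementary-permute {P = P} {Q} π P⇔Q {i} {j} {k} = mk⇔ forth back
  where
  π′ : Fin _ → Fin _
  π′ = π ⟨$⟩ʳ_
  inj : ∀ {x y} → π′ x ≡ π′ y → x ≡ y
  inj = permutation-injective π
  moved : ∀ {x y} → π ⟨$⟩ˡ y ≡ x → y ≡ π′ x
  moved refl = sym (inverseʳ π)
  forth : Complementary P i j k → Complementary Q (π′ i) (π′ j) (π′ k)
  forth ((ij , jk , ik) , f) = (ij ∘ inj , jk ∘ inj , ik ∘ inj) , λ y yi yj yk →
    subst Q (inverseʳ π) (Equivalence.to (P⇔Q (π ⟨$⟩ˡ y)) (f (π ⟨$⟩ˡ y) (yi ∘ moved) (yj ∘ moved) (yk ∘ moved)))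
  back : Complementary Q (π′ i) (π′ j) (π′ k) → Complementary P i j k
  back ((ij , jk , ik) , g) = (ij ∘ cong π′ , jk ∘ cong π′ , ik ∘ cong π′) , λ x xi xj xk →
    Equivalence.from (P⇔Q x) (g (π′ x) (xi ∘ inj) (xj ∘ inj) (xk ∘ inj))

-- On four points a triple is determined by the point it omits.
omitting : (Fin 4 → Fin 4 → Fin 4 → Set) → Fin 4 → Set
omitting H x = H (punchIn x 0F) (punchIn x 1F) (punchIn x 2F)

complementary-punchIn : ∀ {P : Fin 4 → Set} x →
  P x ⇔ Complementary P (punchIn x 0F) (punchIn x 1F) (punchIn x 2F)
complementary-punchIn {P} x = mk⇔
  (λ p → (distinct (λ ()) , distinct (λ ()) , distinct (λ ())) , only-x p)
  (λ (_ , f) → f x (≢-sym (Finₚ.punchInᵢ≢i x 0F)) (≢-sym (Finₚ.punchInᵢ≢i x 1F))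
                   (≢-sym (Finₚ.punchInᵢ≢i x 2F)))
  where
  distinct : ∀ {j k} → j ≢ k → punchIn x j ≢ punchIn x k
  distinct j≢k = j≢k ∘ Finₚ.punchIn-injective x _ _
  only-x : P x → ∀ y → y ≢ punchIn x 0F → y ≢ punchIn x 1F → y ≢ punchIn x 2F → P y
  only-x p y y₀ y₁ y₂ with y Finₚ.≟ x
  ... | yes refl = p
  ... | no y≢x with punchOut (≢-sym y≢x) | Finₚ.punchIn-punchOut (≢-sym y≢x)
  ...   | 0F | e = ⊥-elim (y₀ (sym e))
  ...   | 1F | e = ⊥-elim (y₁ (sym e))
  ...   | 2F | e = ⊥-elim (y₂ (sym e))

edge⇔complementary : ∀ {H : Fin 4 → Fin 4 → Fin 4 → Set} → Is3Hypergraph (Fin 4) H →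
                     ∀ {i j k} → H i j k ⇔ Complementary (omitting H) i j k
edge⇔complementary {H} hyp = mk⇔
  (fromIncreasingTriples Finₚ.<-isStrictTotalOrder hyp (complementary-hypergraph _)
     (onIncreasing λ x → Equivalence.to (complementary-punchIn {omitting H} x)))
  (fromIncreasingTriples Finₚ.<-isStrictTotalOrder (complementary-hypergraph _) hyp
     (onIncreasing λ x → Equivalence.from (complementary-punchIn {omitting H} x)))
  where
  onIncreasing : ∀ {R : Fin 4 → Fin 4 → Fin 4 → Set} →
    (∀ x → R (punchIn x 0F) (punchIn x 1F) (punchIn x 2F)) →
    ∀ {i j k} → i Fin.< j → j Fin.< k → R i j k
  onIncreasing r {i} {j} {k} i<j j<k with increasingTriple₄ i j k i<j j<k
  ... | x , refl , refl , refl = r x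

-- Homogeneous 3-hypergraphs with an invariant linear order

Holds : Bool → Set → Set
Holds true  P = P
Holds false P = ¬ P

holds⇒⇔ : ∀ {b P Q} → Holds b P → Holds b Q → P ⇔ Q
holds⇒⇔ {true}  p  q  = mk⇔ (λ _ → q) (λ _ → p)
holds⇒⇔ {false} ¬p ¬q = mk⇔ (⊥-elim ∘ ¬p) (⊥-elim ∘ ¬q)

Holds-resp-⇔ : ∀ {b P Q} → P ⇔ Q → Holds b P → Holds b Q
Holds-resp-⇔ {true}  P⇔Q p  = Equivalence.to P⇔Q p
Holds-resp-⇔ {false} P⇔Q ¬p = ¬p ∘ Equivalence.from P⇔Q

module StrongDensity (em : ExcludedMiddle 0ℓ) {N : Set} {E : N → N → N → Set} {_≤_ : N → N → Set}
         (S : Setting N E _≤_) where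

  open Setting S using (hypergraph; homogeneous; invariantOrder; linearOrder; config₁; config₂; config₃)
  open Is3Hypergraph hypergraph

  private
    _<_ : N → N → Set
    _<_ = Lt E _≤_

  <-isStrictTotalOrder : IsStrictTotalOrder _≡_ _<_
  <-isStrictTotalOrder = NonStrictToStrict.<-isStrictTotalOrder₁ _≡_ _≤_ (λ _ _ → em) linearOrder

  open IsStrictTotalOrder <-isStrictTotalOrder using (compare; irrefl; asym) renaming (trans to <-trans)

  rotate : ∀ {x y z} → E x y z → E y z x
  rotate = swap₂₃ ∘ swap₁₂

  reverse : ∀ {x y z} → E x y z → E z y x
  reverse = swap₁₂ ∘ swap₂₃ ∘ swap₁₂

  Increasing : ∀ {n} → Vec N n → Set
  Increasing = Linked _<_

  SameEdges : ∀ {n} → Vec N n → Vec N n → Set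
  SameEdges xs ys = ∀ i j k →
    E (lookup xs i) (lookup xs j) (lookup xs k) ⇔ E (lookup ys i) (lookup ys j) (lookup ys k)

  SameEdgesOnIncreasing : ∀ {n} → Vec N n → Vec N n → Set
  SameEdgesOnIncreasing xs ys = ∀ {i j k} → i Fin.< j → j Fin.< k →
    E (lookup xs i) (lookup xs j) (lookup xs k) ⇔ E (lookup ys i) (lookup ys j) (lookup ys k)

  sameEdges : ∀ {n} {xs ys : Vec N n} → SameEdgesOnIncreasing xs ys → SameEdges xs ys
  sameEdges {xs = xs} {ys} same i j k = mk⇔
    (fromIncreasingTriples Finₚ.<-isStrictTotalOrder hyp-xs hyp-ys (Equivalence.to ∘₂ same))
    (fromIncreasingTriples Finₚ.<-isStrictTotalOrder hyp-ys hyp-xs (Equivalence.from ∘₂ same))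
    where
    hyp-xs : Is3Hypergraph (Fin _) (λ i j k → E (lookup xs i) (lookup xs j) (lookup xs k))
    hyp-xs = pullback hypergraph (lookup xs)
    hyp-ys : Is3Hypergraph (Fin _) (λ i j k → E (lookup ys i) (lookup ys j) (lookup ys k))
    hyp-ys = pullback hypergraph (lookup ys)

  sameEdgesOnIncreasing-≤2 : ∀ {n} {n≤2 : True (n ℕ.≤? 2)} (xs ys : Vec N n) →
                             SameEdgesOnIncreasing xs ys
  sameEdgesOnIncreasing-≤2 {n≤2 = n≤2} _ _ i<j j<k =
    ⊥-elim (noIncreasingTriple (toWitness n≤2) i<j j<k)

  Edge : Vec N 3 → Set
  Edge t = E (lookup t 0F) (lookup t 1F) (lookup t 2F)

  sameEdgesOnIncreasing-triple : ∀ {zs ys : Vec N 3} → Edge zs ⇔ Edge ys → SameEdgesOnIncreasing zs ys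
  sameEdgesOnIncreasing-triple same {i} {j} {k} i<j j<k with increasingTriple₃ i j k i<j j<k
  ... | refl , refl , refl = same

  increasing⇒injective : ∀ {n} {xs : Vec N n} → Increasing xs → Injective _≡_ _≡_ (lookup xs)
  increasing⇒injective xs↑ {i} {j} eq with Finₚ.<-cmp i j
  ... | tri< i<j _ _ = ⊥-elim (irrefl eq (linked⇒lookup-mono <-trans xs↑ i<j))
  ... | tri≈ _ i≡j _ = i≡j
  ... | tri> _ _ j<i = ⊥-elim (irrefl (sym eq) (linked⇒lookup-mono <-trans xs↑ j<i))

  increasing-reflects : ∀ {n} {xs : Vec N n} → Increasing xs →
                        ∀ {i j} → lookup xs i < lookup xs j → i Fin.< j
  increasing-reflects xs↑ {i} {j} xsi<xsj with Finₚ.<-cmp i j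
  ... | tri< i<j _ _ = i<j
  ... | tri≈ _ refl _ = ⊥-elim (irrefl refl xsi<xsj)
  ... | tri> _ _ j<i = ⊥-elim (asym xsi<xsj (linked⇒lookup-mono <-trans xs↑ j<i))

  record OrderAutomorphism : Set where
    field
      to          : N → N
      mono        : ∀ {x y} → x < y → to x < to y
      preserves-E : ∀ {x y z} → E x y z ⇔ E (to x) (to y) (to z)

  open OrderAutomorphism

  fromAutomorphism : (g : N ⤖ N) → IsAut E g → OrderAutomorphism
  fromAutomorphism g g-aut = record
    { to          = Bijection.to g
    ; mono        = λ {x} {y} (x≤y , x≢y) →
                      invariantOrder g g-aut x y x≤y , x≢y ∘ Bijection.injective g
    ; preserves-E = λ {x} {y} {z} → g-aut x y z
    }

  map-increasing : ∀ g {n} {xs : Vec N n} → Increasing xs → Increasing (map (to g) xs)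
  map-increasing g = Linkedₚ.map⁺ ∘ Linked.map (mono g)

  map-sameEdges : ∀ g {n} (xs : Vec N n) → SameEdges xs (map (to g) xs)
  map-sameEdges g xs i j k
    rewrite lookup-map i (to g) xs | lookup-map j (to g) xs | lookup-map k (to g) xs = preserves-E g

  -- By ≤4-set-homogeneity some automorphism maps the set xs onto the set ys;
  -- being order preserving, it must map xs to ys entrywise.
  transport : ∀ {t} → t ℕ.≤ 4 → {xs ys : Vec N t} → Increasing xs → Increasing ys →
    (π : Permutation′ t) →
    (∀ i j k → E (lookup xs i) (lookup xs j) (lookup xs k) ⇔
               E (lookup ys (π ⟨$⟩ʳ i)) (lookup ys (π ⟨$⟩ʳ j)) (lookup ys (π ⟨$⟩ʳ k))) →
    ∃[ g ] map (to g) xs ≡ ys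
  transport t≤4 {xs} {ys} xs↑ ys↑ π xs≅ys
    with homogeneous _ t≤4 (lookup xs) (lookup ys)
                     (increasing⇒injective xs↑) (increasing⇒injective ys↑)
                     ((π ⟨$⟩ʳ_) , permutation-injective π , xs≅ys)
  ... | g , g-aut , onto , _ = h , lookup-ext λ i → begin
        lookup (map (to h) xs) i ≡⟨ lookup-map i (to h) xs ⟩
        to h (lookup xs i)       ≡⟨ proj₂ (onto i) ⟩
        lookup ys (σ i)          ≡⟨ cong (lookup ys) (strictlyIncreasing⇒≗id σ σ↑ i) ⟩
        lookup ys i              ∎
    where
    open ≡-Reasoning
    h : OrderAutomorphism
    h = fromAutomorphism g g-aut
    σ : Fin _ → Fin _
    σ i = proj₁ (onto i)
    σ↑ : StrictlyIncreasing σ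
    σ↑ {i} {j} i<j = increasing-reflects ys↑
      (subst₂ _<_ (proj₂ (onto i)) (proj₂ (onto j)) (mono h (linked⇒lookup-mono <-trans xs↑ i<j)))

  -- The entry of xs at position k can be inserted into ys at the same position,
  -- by the automorphism that carries the rest of xs onto ys.
  extend : ∀ {t} {t≤4 : True (t ℕ.≤? 4)} {xs : Vec N (suc t)} → Increasing xs →
    (k : Fin (suc t)) →
    {ys : Vec N t} → Increasing ys → SameEdgesOnIncreasing (removeAt xs k) ys →
    ∃[ w ] (Increasing (insertAt ys k w) × SameEdges xs (insertAt ys k w))
  extend {t≤4 = t≤4} {xs} xs↑ k {ys} ys↑ same
    with transport (toWitness t≤4) zs↑ ys↑ Perm.id (sameEdges {xs = removeAt xs k} {ys} same)
    where
    zs↑ : Increasing (removeAt xs k)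
    zs↑ = lookup-mono⇒linked λ {i} {j} i<j →
      subst₂ _<_ (lookup-removeAt i) (lookup-removeAt j)
        (linked⇒lookup-mono <-trans xs↑ (punchIn-strictlyIncreasing k i<j))
      where
      lookup-removeAt : ∀ i → lookup xs (punchIn k i) ≡ lookup (removeAt xs k) i
      lookup-removeAt i = trans (cong (λ r → lookup r (punchIn k i)) (sym (insertAt-removeAt xs k)))
                                (insertAt-punchIn (removeAt xs k) k (lookup xs k) i)
  ... | g , gzs≡ys = to g (lookup xs k) , subst (λ r → Increasing r × SameEdges xs r) image
                                                (map-increasing g xs↑ , map-sameEdges g xs)
    where
    open ≡-Reasoning
    image : map (to g) xs ≡ insertAt ys k (to g (lookup xs k))
    image = begin
      map (to g) xs
        ≡⟨ cong (map (to g)) (insertAt-removeAt xs k) ⟨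
      map (to g) (insertAt (removeAt xs k) k (lookup xs k))
        ≡⟨ map-insertAt (to g) (lookup xs k) (removeAt xs k) k ⟩
      insertAt (map (to g) (removeAt xs k)) k (to g (lookup xs k))
        ≡⟨ cong (λ r → insertAt r k (to g (lookup xs k))) gzs≡ys ⟩
      insertAt ys k (to g (lookup xs k))
        ∎

  extendTriple : ∀ {xs : Vec N 4} → Increasing xs → (k : Fin 4) → ∀ {x y z} → x < y → y < z →
    Edge (removeAt xs k) ⇔ E x y z →
    ∃[ w ] (Increasing (insertAt (x ∷ y ∷ z ∷ []) k w) ×
            SameEdges xs (insertAt (x ∷ y ∷ z ∷ []) k w))
  extendTriple {xs} xs↑ k {x} {y} {z} x<y y<z same =
    extend xs↑ k (x<y ∷ y<z ∷ [-])
      (sameEdgesOnIncreasing-triple {removeAt xs k} {x ∷ y ∷ z ∷ []} same)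

  EdgeOmitting : Vec N 4 → Fin 4 → Set
  EdgeOmitting u = omitting λ i j k → E (lookup u i) (lookup u j) (lookup u k)

  omitted⇒isomorphism : ∀ {u v : Vec N 4} (π : Permutation′ 4) →
    (∀ x → EdgeOmitting u x ⇔ EdgeOmitting v (π ⟨$⟩ʳ x)) →
    ∀ i j k → E (lookup u i) (lookup u j) (lookup u k) ⇔
              E (lookup v (π ⟨$⟩ʳ i)) (lookup v (π ⟨$⟩ʳ j)) (lookup v (π ⟨$⟩ʳ k))
  omitted⇒isomorphism {u} {v} π u≅v i j k =
      ⇔.trans (edge⇔complementary (pullback hypergraph (lookup u)))
        (⇔.trans (complementary-permute {P = EdgeOmitting u} {Q = EdgeOmitting v} π u≅v)
          (⇔.sym (edge⇔complementary (pullback hypergraph (lookup v)))))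

  isomorphic⇒samePattern : ∀ {u v : Vec N 4} → Increasing u → Increasing v → (π : Permutation′ 4) →
    (∀ x → EdgeOmitting u x ⇔ EdgeOmitting v (π ⟨$⟩ʳ x)) →
    ∀ x → EdgeOmitting u x ⇔ EdgeOmitting v x
  isomorphic⇒samePattern {u} {v} u↑ v↑ π u≅v x =
    let (g , gu≡v) = transport ℕₚ.≤-refl u↑ v↑ π (omitted⇒isomorphism {u} {v} π u≅v)
    in subst (λ r → EdgeOmitting u x ⇔ EdgeOmitting r x) gu≡v
             (map-sameEdges g u (punchIn x 0F) (punchIn x 1F) (punchIn x 2F))

  record Quadruple (abc abd acd bcd : Bool) : Set where
    constructor quadruple
    field
      {a b c d} : N
      a<b       : a < b
      b<c       : b < c
      c<d       : c < d
      E-abc     : Holds abc (E a b c)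
      E-abd     : Holds abd (E a b d)
      E-acd     : Holds acd (E a c d)
      E-bcd     : Holds bcd (E b c d)

    points : Vec N 4
    points = a ∷ b ∷ c ∷ d ∷ []

    increasing : Increasing points
    increasing = a<b ∷ b<c ∷ c<d ∷ [-]

  oneEdge : Quadruple true false false false
  oneEdge = let (_ , _ , _ , _ , a<b , b<c , c<d , abc , abd , acd , bcd) = config₁
            in quadruple a<b b<c c<d abc abd acd bcd

  twoEdges : Quadruple false false true true
  twoEdges = let (_ , _ , _ , _ , a<b , b<c , c<d , abc , abd , acd , bcd) = config₂
             in quadruple a<b b<c c<d abc abd acd bcd

  threeEdges : Quadruple true true true false
  threeEdges = let (_ , _ , _ , _ , a<b , b<c , c<d , abc , abd , acd , bcd) = config₃
               in quadruple a<b b<c c<d abc abd acd bcd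

  module One   = Quadruple oneEdge
  module Two   = Quadruple twoEdges
  module Three = Quadruple threeEdges

  -- Each failing case has as many edges as one of the configurations, which is carried onto it
  -- by a transposition; isomorphic⇒samePattern then forces the two patterns to agree.
  abc∧bcd⇒abd∧acd : ∀ {a b c d} → a < b → b < c → c < d →
                    E a b c → E b c d → E a b d × E a c d
  abc∧bcd⇒abd∧acd {a} {b} {c} {d} a<b b<c c<d abc bcd = cases em em
    where
    abcd↑ : Increasing (a ∷ b ∷ c ∷ d ∷ [])
    abcd↑ = a<b ∷ b<c ∷ c<d ∷ [-]
    cases : Dec (E a b d) → Dec (E a c d) → E a b d × E a c d
    cases (yes abd) (yes acd) = abd , acd
    cases (no ¬abd) (no ¬acd) = ⊥-elim (Two.E-abc (Equivalence.from (same 3F) abc))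
      where
      same : ∀ x → EdgeOmitting Two.points x ⇔ EdgeOmitting (a ∷ b ∷ c ∷ d ∷ []) x
      same = isomorphic⇒samePattern Two.increasing abcd↑ (transpose 1F 3F) λ where
        0F → holds⇒⇔ Two.E-bcd bcd ; 1F → holds⇒⇔ Two.E-acd abc
        2F → holds⇒⇔ Two.E-abd ¬abd ; 3F → holds⇒⇔ Two.E-abc ¬acd
    cases (yes abd) (no ¬acd) = ⊥-elim (Three.E-bcd (Equivalence.from (same 0F) bcd))
      where
      same : ∀ x → EdgeOmitting Three.points x ⇔ EdgeOmitting (a ∷ b ∷ c ∷ d ∷ []) x
      same = isomorphic⇒samePattern Three.increasing abcd↑ (transpose 0F 1F) λ where
        0F → holds⇒⇔ Three.E-bcd ¬acd ; 1F → holds⇒⇔ Three.E-acd bcd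
        2F → holds⇒⇔ Three.E-abd abd ; 3F → holds⇒⇔ Three.E-abc abc
    cases (no ¬abd) (yes acd) = ⊥-elim (Three.E-bcd (Equivalence.from (same 0F) bcd))
      where
      same : ∀ x → EdgeOmitting Three.points x ⇔ EdgeOmitting (a ∷ b ∷ c ∷ d ∷ []) x
      same = isomorphic⇒samePattern Three.increasing abcd↑ (transpose 0F 2F) λ where
        0F → holds⇒⇔ Three.E-bcd ¬abd ; 1F → holds⇒⇔ Three.E-acd acd
        2F → holds⇒⇔ Three.E-abd bcd ; 3F → holds⇒⇔ Three.E-abc abc

  ¬abc∧¬acd⇒¬abd∧¬bcd : ∀ {a b c d} → a < b → b < c → c < d →
                        ¬ E a b c → ¬ E a c d → ¬ E a b d × ¬ E b c d
  ¬abc∧¬acd⇒¬abd∧¬bcd {a} {b} {c} {d} a<b b<c c<d ¬abc ¬acd = cases em em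
    where
    abcd↑ : Increasing (a ∷ b ∷ c ∷ d ∷ [])
    abcd↑ = a<b ∷ b<c ∷ c<d ∷ [-]
    cases : Dec (E a b d) → Dec (E b c d) → ¬ E a b d × ¬ E b c d
    cases (no ¬abd) (no ¬bcd) = ¬abd , ¬bcd
    cases (yes abd) (yes bcd) = ⊥-elim (¬acd (Equivalence.to (same 1F) Two.E-acd))
      where
      same : ∀ x → EdgeOmitting Two.points x ⇔ EdgeOmitting (a ∷ b ∷ c ∷ d ∷ []) x
      same = isomorphic⇒samePattern Two.increasing abcd↑ (transpose 1F 2F) λ where
        0F → holds⇒⇔ Two.E-bcd bcd ; 1F → holds⇒⇔ Two.E-acd abd
        2F → holds⇒⇔ Two.E-abd ¬acd ; 3F → holds⇒⇔ Two.E-abc ¬abc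
    cases (no ¬abd) (yes bcd) = ⊥-elim (¬abc (Equivalence.to (same 3F) One.E-abc))
      where
      same : ∀ x → EdgeOmitting One.points x ⇔ EdgeOmitting (a ∷ b ∷ c ∷ d ∷ []) x
      same = isomorphic⇒samePattern One.increasing abcd↑ (transpose 0F 3F) λ where
        0F → holds⇒⇔ One.E-bcd ¬abc ; 1F → holds⇒⇔ One.E-acd ¬acd
        2F → holds⇒⇔ One.E-abd ¬abd ; 3F → holds⇒⇔ One.E-abc bcd
    cases (yes abd) (no ¬bcd) = ⊥-elim (¬abc (Equivalence.to (same 3F) One.E-abc))
      where
      same : ∀ x → EdgeOmitting One.points x ⇔ EdgeOmitting (a ∷ b ∷ c ∷ d ∷ []) x
      same = isomorphic⇒samePattern One.increasing abcd↑ (transpose 2F 3F) λ where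
        0F → holds⇒⇔ One.E-bcd ¬bcd ; 1F → holds⇒⇔ One.E-acd ¬acd
        2F → holds⇒⇔ One.E-abd ¬abc ; 3F → holds⇒⇔ One.E-abc abd

  -- (b, c, w) is placed like (a, b, c), so it is an edge.
  completeQuadruple : Quadruple true true true true
  completeQuadruple = case extendTriple One.increasing 2F One.b<c One.c<d
                                        (holds⇒⇔ One.E-abd One.E-bcd) of λ where
    (w , _ ∷ c<w ∷ _ ∷ [-] , same) →
      let bcw         = Equivalence.to (same 0F 1F 2F) One.E-abc
          (abw , acw) = abc∧bcd⇒abd∧acd One.a<b One.b<c c<w One.E-abc bcw
      in quadruple One.a<b One.b<c c<w One.E-abc abw acw bcw

  -- (a, c, w) of twoEdges is placed like (a, b, d) of oneEdge, so it is not an edge.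
  emptyQuadruple : Quadruple false false false false
  emptyQuadruple = case extendTriple One.increasing 3F (<-trans Two.a<b Two.b<c) Two.c<d
                                        (holds⇒⇔ One.E-abc Two.E-acd) of λ where
    (w , _ ∷ _ ∷ d<w ∷ [-] , same) →
      let c<w           = <-trans Two.c<d d<w
          ¬acw          = One.E-abd ∘ Equivalence.from (same 0F 1F 3F)
          (¬abw , ¬bcw) = ¬abc∧¬acd⇒¬abd∧¬bcd Two.a<b Two.b<c c<w Two.E-abc ¬acw
      in quadruple Two.a<b Two.b<c c<w Two.E-abc ¬abw ¬acw ¬bcw

  module Complete = Quadruple completeQuadruple
  module Empty    = Quadruple emptyQuadruple

  extendPair : ∀ (e : Bool) (k : Fin 3) {p q} → p < q →
    ∃[ w ] (Increasing (insertAt (p ∷ q ∷ []) k w) × Holds e (Edge (insertAt (p ∷ q ∷ []) k w)))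
  extendPair e k {p} {q} p<q =
    let (t , t↑ , te)   = triangle e
        (w , r↑ , same) =
          extend t↑ k (p<q ∷ [-]) (sameEdgesOnIncreasing-≤2 (removeAt t k) (p ∷ q ∷ []))
    in w , r↑ , Holds-resp-⇔ (same 0F 1F 2F) te
    where
    triangle : ∀ e → ∃[ t ] (Increasing t × Holds e (Edge t))
    triangle true  = One.a ∷ One.b ∷ One.c ∷ [] , One.a<b ∷ One.b<c ∷ [-] , One.E-abc
    triangle false = One.a ∷ One.b ∷ One.d ∷ [] , One.a<b ∷ <-trans One.b<c One.c<d ∷ [-] , One.E-abd

  C′ : N → N → N → Set
  C′ = C E _≤_

  C-diagonal : ∀ {x y} → y ≢ x → C′ x y y
  C-diagonal y≢x = inj₁ (refl , y≢x)

  C-edge : ∀ {x y z} → x < y → x < z → E x y z → C′ x y z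
  C-edge x<y x<z e = inj₂ (inj₁ (distinct e , x<y , x<z , e))

  C-nonEdge : ∀ {x y z} → y < x → z < x → y ≢ z → ¬ E x y z → C′ x y z
  C-nonEdge y<x z<x y≢z ¬e =
    inj₂ (inj₂ ((≢-sym (proj₂ y<x) , y≢z , ≢-sym (proj₂ z<x)) , y<x , z<x , ¬e))

  C-swap : ∀ {x y z} → C′ x y z → C′ x z y
  C-swap (inj₁ (refl , y≢x))               = C-diagonal y≢x
  C-swap (inj₂ (inj₁ (_ , x<y , x<z , e))) = C-edge x<z x<y (swap₂₃ e)
  C-swap (inj₂ (inj₂ ((_ , y≢z , _) , y<x , z<x , ¬e))) =
    C-nonEdge z<x y<x (≢-sym y≢z) (¬e ∘ swap₂₃)

  compatible : Compatible E _≤_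
  compatible x y z x<y y<z with em {E x y z}
  ... | yes e = inj₁ (C-edge x<y (<-trans x<y y<z) e)
  ... | no ¬e = inj₂ (C-nonEdge (<-trans x<y y<z) y<z (proj₂ x<y) (¬e ∘ rotate))

  dense : ∀ x y → x < y → ∃[ z ] (x < z × z < y)
  dense x y x<y = case extendPair true 1F x<y of λ where
    (w , x<w ∷ w<y ∷ [-] , _) → w , x<w , w<y

  unboundedBelow : ∀ x → ∃[ y ] y < x
  unboundedBelow x =
    case extend (One.a<b ∷ [-]) 0F [-] (sameEdgesOnIncreasing-≤2 (One.b ∷ []) (x ∷ [])) of λ where
      (w , w<x ∷ [-] , _) → w , w<x

  unboundedAbove : ∀ x → ∃[ y ] x < y
  unboundedAbove x =
    case extend (One.a<b ∷ [-]) 1F [-] (sameEdgesOnIncreasing-≤2 (One.a ∷ []) (x ∷ [])) of λ where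
      (w , x<w ∷ [-] , _) → w , x<w

  edgeBelow : ∀ {y z} → y < z → ∃[ w ] C′ w y z
  edgeBelow y<z = case extendPair true 0F y<z of λ where
    (w , w<y ∷ _ , e) → w , C-edge w<y (<-trans w<y y<z) e

  C5-holds : C5 E _≤_
  C5-holds y z with compare y z
  ... | tri< y<z _ _ = edgeBelow y<z
  ... | tri≈ _ refl _ = let (w , w<y) = unboundedBelow y in w , C-diagonal (≢-sym (proj₂ w<y))
  ... | tri> _ _ z<y = let (w , c) = edgeBelow z<y in w , C-swap c

  C6-holds : C6 E _≤_
  C6-holds x y x≢y with compare x y
  ... | tri< x<y _ _ = case extendPair true 2F x<y of λ where
    (w , _ ∷ y<w ∷ [-] , e) → w , proj₂ y<w , C-edge x<y (<-trans x<y y<w) e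
  ... | tri≈ _ x≡y _ = ⊥-elim (x≢y x≡y)
  ... | tri> _ _ y<x = case extendPair false 0F y<x of λ where
    (w , w<y ∷ _ , ¬wyx) →
      let y≢w = ≢-sym (proj₂ w<y)
      in w , y≢w , C-nonEdge y<x (<-trans w<y y<x) y≢w (¬wyx ∘ reverse)

  -- Each case copies a pair, triple or quadruple in which the required relations hold,
  -- inserting w at the position those relations prescribe.
  witnessBelow : ∀ {x y z} → C′ x y z → ∃[ w ] (C′ w y z × C′ x y w × w < y × w < z)
  witnessBelow {x} {y} (inj₁ (refl , y≢x)) with compare x y
  ... | tri< x<y _ _ = case extendPair true 1F x<y of λ where
    (w , x<w ∷ w<y ∷ [-] , xwy) →
      w , C-diagonal (≢-sym (proj₂ w<y)) , C-edge x<y x<w (swap₂₃ xwy) , w<y , w<y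
  ... | tri≈ _ x≡y _ = ⊥-elim (y≢x (sym x≡y))
  ... | tri> _ _ y<x = case extendPair false 0F y<x of λ where
    (w , w<y ∷ _ , ¬wyx) →
      let y≢w = ≢-sym (proj₂ w<y)
      in w , C-diagonal y≢w , C-nonEdge y<x (<-trans w<y y<x) y≢w (¬wyx ∘ reverse) , w<y , w<y
  witnessBelow {x} {y} {z} (inj₂ (inj₁ (_ , x<y , x<z , xyz))) with compare y z
  ... | tri< y<z _ _ = case extendTriple Complete.increasing 1F x<y y<z
                         (holds⇒⇔ Complete.E-acd xyz) of λ where
    (w , x<w ∷ w<y ∷ _ , same) →
      let wyz = Equivalence.to (same 1F 2F 3F) Complete.E-bcd
          xwy = Equivalence.to (same 0F 1F 2F) Complete.E-abc
          w<z = <-trans w<y y<z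
      in w , C-edge w<y w<z wyz , C-edge x<y x<w (swap₂₃ xwy) , w<y , w<z
  ... | tri≈ _ y≡z _ = ⊥-elim (proj₁ (proj₂ (distinct xyz)) y≡z)
  ... | tri> _ _ z<y = case extendTriple Complete.increasing 1F x<z z<y
                         (holds⇒⇔ Complete.E-acd (swap₂₃ xyz)) of λ where
    (w , x<w ∷ w<z ∷ _ , same) →
      let wzy = Equivalence.to (same 1F 2F 3F) Complete.E-bcd
          xwy = Equivalence.to (same 0F 1F 3F) Complete.E-abd
          w<y = <-trans w<z z<y
      in w , C-edge w<y w<z (swap₂₃ wzy) , C-edge x<y x<w (swap₂₃ xwy) , w<y , w<z
  witnessBelow {x} {y} {z} (inj₂ (inj₂ ((_ , y≢z , _) , y<x , z<x , ¬xyz))) with compare y z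
  ... | tri< y<z _ _ = case extendTriple One.increasing 0F y<z z<x
                         (holds⇒⇔ One.E-bcd (¬xyz ∘ rotate ∘ rotate)) of λ where
    (w , w<y ∷ _ , same) →
      let wyz  = Equivalence.to (same 0F 1F 2F) One.E-abc
          ¬wyx = One.E-abd ∘ Equivalence.from (same 0F 1F 3F)
          w<z  = <-trans w<y y<z
      in w , C-edge w<y w<z wyz , C-nonEdge y<x (<-trans w<y y<x) (≢-sym (proj₂ w<y)) (¬wyx ∘ reverse) ,
         w<y , w<z
  ... | tri≈ _ y≡z _ = ⊥-elim (y≢z y≡z)
  ... | tri> _ _ z<y = case extendTriple One.increasing 0F z<y y<x
                         (holds⇒⇔ One.E-bcd (¬xyz ∘ reverse)) of λ where
    (w , w<z ∷ _ , same) →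
      let wzy  = Equivalence.to (same 0F 1F 2F) One.E-abc
          ¬wyx = One.E-acd ∘ Equivalence.from (same 0F 2F 3F)
          w<y  = <-trans w<z z<y
      in w , C-edge w<y w<z (swap₂₃ wzy) ,
         C-nonEdge y<x (<-trans w<y y<x) (≢-sym (proj₂ w<y)) (¬wyx ∘ reverse) ,
         w<y , w<z

  witnessAbove : ∀ {x y z} → C′ x y z → ∃[ w ] (C′ w y z × C′ x y w × y < w × z < w)
  witnessAbove {x} {y} (inj₁ (refl , y≢x)) with compare x y
  ... | tri< x<y _ _ = case extendPair true 2F x<y of λ where
    (w , _ ∷ y<w ∷ [-] , xyw) →
      w , C-diagonal (proj₂ y<w) , C-edge x<y (<-trans x<y y<w) xyw , y<w , y<w
  ... | tri≈ _ x≡y _ = ⊥-elim (y≢x (sym x≡y))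
  ... | tri> _ _ y<x = case extendPair false 1F y<x of λ where
    (w , y<w ∷ w<x ∷ [-] , ¬ywx) →
      w , C-diagonal (proj₂ y<w) , C-nonEdge y<x w<x (proj₂ y<w) (¬ywx ∘ rotate) , y<w , y<w
  witnessAbove {x} {y} {z} (inj₂ (inj₁ ((_ , y≢z , _) , x<y , x<z , xyz))) with compare y z
  ... | tri< y<z _ _ = case extendTriple Three.increasing 3F x<y y<z (holds⇒⇔ Three.E-abc xyz) of λ where
    (w , _ ∷ _ ∷ z<w ∷ [-] , same) →
      let ¬yzw = Three.E-bcd ∘ Equivalence.from (same 1F 2F 3F)
          xyw  = Equivalence.to (same 0F 1F 3F) Three.E-abd
          y<w  = <-trans y<z z<w
      in w , C-nonEdge y<w z<w y≢z (¬yzw ∘ rotate) , C-edge x<y (<-trans x<y y<w) xyw , y<w , z<w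
  ... | tri≈ _ y≡z _ = ⊥-elim (y≢z y≡z)
  ... | tri> _ _ z<y = case extendTriple Three.increasing 3F x<z z<y
                         (holds⇒⇔ Three.E-abc (swap₂₃ xyz)) of λ where
    (w , _ ∷ _ ∷ y<w ∷ [-] , same) →
      let ¬zyw = Three.E-bcd ∘ Equivalence.from (same 1F 2F 3F)
          xyw  = Equivalence.to (same 0F 2F 3F) Three.E-acd
          z<w  = <-trans z<y y<w
      in w , C-nonEdge y<w z<w y≢z (¬zyw ∘ reverse) , C-edge x<y (<-trans x<y y<w) xyw , y<w , z<w
  witnessAbove {x} {y} {z} (inj₂ (inj₂ ((_ , y≢z , _) , y<x , z<x , ¬xyz))) with compare y z
  ... | tri< y<z _ _ = case extendTriple Empty.increasing 2F y<z z<x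
                         (holds⇒⇔ Empty.E-abd (¬xyz ∘ rotate ∘ rotate)) of λ where
    (w , _ ∷ z<w ∷ w<x ∷ [-] , same) →
      let ¬yzw = Empty.E-abc ∘ Equivalence.from (same 0F 1F 2F)
          ¬ywx = Empty.E-acd ∘ Equivalence.from (same 0F 2F 3F)
          y<w  = <-trans y<z z<w
      in w , C-nonEdge y<w z<w y≢z (¬yzw ∘ rotate) , C-nonEdge y<x w<x (proj₂ y<w) (¬ywx ∘ rotate) ,
         y<w , z<w
  ... | tri≈ _ y≡z _ = ⊥-elim (y≢z y≡z)
  ... | tri> _ _ z<y = case extendTriple Empty.increasing 2F z<y y<x
                         (holds⇒⇔ Empty.E-abd (¬xyz ∘ reverse)) of λ where
    (w , _ ∷ y<w ∷ w<x ∷ [-] , same) →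
      let ¬zyw = Empty.E-abc ∘ Equivalence.from (same 0F 1F 2F)
          ¬ywx = Empty.E-bcd ∘ Equivalence.from (same 1F 2F 3F)
          z<w  = <-trans z<y y<w
      in w , C-nonEdge y<w z<w y≢z (¬zyw ∘ reverse) , C-nonEdge y<x w<x (proj₂ y<w) (¬ywx ∘ rotate) ,
         y<w , z<w

  C8-holds : C8 E _≤_
  C8-holds x y z Cxyz = witnessBelow Cxyz , witnessAbove Cxyz

lemma3p11 : ExcludedMiddle 0ℓ →
    ∀ {N : Set} {E : N → N → N → Set} {_≤_ : N → N → Set} →
    Setting N E _≤_ →
    Compatible E _≤_ × StronglyDense E _≤_
lemma3p11 em S = compatible , (C5-holds , C6-holds) , (dense , unboundedBelow , unboundedAbove) , C8-holds
  where open StrongDensity em S
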